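{- Let $\mathcal{R}$ be a locally confluent rewrite system on terms. Then the proof reduction algorithm for asymmetric atomic deduction modulo $\mathcal{R}$ described below never fails: whenever a reduction step is applied to a cut whose two premises have cut-free proofs, one of the cases (1), (2), (3) applies.
   Context: Fix a first-order language. A rewrite rule is a pair of terms $l \rightarrow r$ with $l$ not a variable; a rewrite system is a set of rules. $\rightarrow^{1}$ is the smallest relation on terms and propositions compatible with their structure and containing $\theta l \rightarrow^{1} \theta r$ for every substitution $\theta$ and rule $l \rightarrow r$; $\rightarrow^{+}$ and $\rightarrow^{*}$ are its transitive and reflexive-transitive closures, $\leftarrow$ denotes converses. $\mathcal{R}$ is locally confluent if whenever $u \leftarrow^{1} t \rightarrow^{1} v$ there is $w$ with $u \rightarrow^{*} w \leftarrow^{*} v$. Two propositions have a common reduct $D$ if both rewrite to $D$ by $\rightarrow^{*}$. Asymmetric atomic deduction modulo $\mathcal{R}$: all propositions are atomic, sequents $\Gamma \vdash \Delta$ have finite multisets, and the rules are: Axiom with cut-free label $(A)$: $\Gamma, A_1 \vdash A_2, \Delta$ provided $A_1 \rightarrow^{*} A \leftarrow^{*} A_2$; Cut with cut proposition $(C)$: from $\Gamma \vdash C_1, \Delta$ and $\Gamma, C_2 \vdash \Delta$ infer $\Gamma \vdash \Delta$ provided $C_1 \leftarrow^{*} C \rightarrow^{*} C_2$; contraction-left/right: from $\Gamma, A_1, A_2 \vdash \Delta$ (resp. $\Gamma \vdash A_1,A_2,\Delta$) infer $\Gamma, A \vdash \Delta$ (resp. $\Gamma \vdash A,\Delta$) provided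 $A_1 \leftarrow^{*} A \rightarrow^{*} A_2$; weakening-left/right. A cut-free proof of $\Gamma \vdash \Delta$ exists iff some $A \in \Gamma$ and $B \in \Delta$ have a common reduct. Reduction step: consider a proof ending with a Cut with cut proposition $C$, conclusion $\Gamma \vdash \Delta$, premises $\Gamma \vdash C_1, \Delta$ and $\Gamma, C_2 \vdash \Delta$ (with $C_1 \leftarrow^{*} C \rightarrow^{*} C_2$), both having cut-free proofs. (1) If some proposition of $\Gamma$ and some proposition of $\Delta$ have a common reduct $C'$, the proof is replaced by an Axiom $(C')$ proving $\Gamma \vdash \Delta$. Otherwise write $\Gamma = \Gamma', A$ and $\Delta = E, \Delta'$ where $A$ and $C_1$ have a common reduct $B$ and $E$ and $C_2$ have a common reduct $D$. (2) If $B = C$ or $C = D$, then $D$ or $B$ is a common reduct of $A$ and $E$ and the proof is replaced by the corresponding Axiom. Otherwise $B \leftarrow^{+} C \rightarrow^{+} D$, so pick $C'_1, C'_2$ with $C \rightarrow^{1} C'_1 \rightarrow^{*} B$ and $C \rightarrow^{1} C'_2 \rightarrow^{*} D$. (3) If $C'_1$ and $C'_2$ have a common reduct $C'$, the proof is replaced by the proof ending with a Cut $(C'_2)$ of conclusion $\Gamma', A \vdash E, \Delta'$ whose right premise is the Axiom $(D)$ proving $\Gamma', A, C'_2 \vdash E, \Delta'$ and whose left premise is a Cut $(C'_1)$ of conclusion $\Gamma', A \vdash C'_2, E, \Delta'$ with premises the Axiom $(B)$ proving $\Gamma', A \vdash C'_1, C'_2, E, \Delta'$ and the Axiom $(C')$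 proving $\Gamma', A, C'_1 \vdash C'_2, E, \Delta'$. If none of (1), (2), (3) applies, the reduction step fails. The proof reduction algorithm repeatedly applies the reduction step to a highest cut of the proof (one whose premises have cut-free proofs), until the proof is cut-free or a step fails. -}

module Defs where

open import Data.Nat using (ℕ)
open import Data.Vec using (Vec; []; _∷_)
open import Data.List using (List; _∷_)
open import Data.List.Membership.Propositional using (_∈_)
open import Data.List.Relation.Binary.Permutation.Propositional using (_↭_)
open import Data.Product using (Σ; ∃; ∃-syntax; _×_; _,_)
open import Data.Bool using (Bool)
open import Data.Unit using (⊤)
open import Data.Empty using (⊥)
open import Relation.Nullary using (¬_)
open import Relation.Binary.PropositionalEquality using (_≡_; _≢_)
open import Relation.Binary.Construct.Closure.ReflexiveTransitive using (Star)

record Signature : Set₁ where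
  field
    Fun      : Set
    funArity : Fun → ℕ
    Pred     : Set
    predArity : Pred → ℕ
open Signature public

data Term (S : Signature) : Set where
  var : ℕ → Term S
  fun : (f : Fun S) → Vec (Term S) (funArity S f) → Term S

data Prop (S : Signature) : Set where
  pred : (P : Pred S) → Vec (Term S) (predArity S P) → Prop S

Subst : Signature → Set
Subst S = ℕ → Term S

mutual
  subst : {S : Signature} → Subst S → Term S → Term S
  subst θ (var x)    = θ x
  subst θ (fun f ts) = fun f (substs θ ts)

  substs : {S : Signature} {n : ℕ} → Subst S → Vec (Term S) n → Vec (Term S) n
  substs θ []       = []
  substs θ (t ∷ ts) = subst θ t ∷ substs θ ts

IsVar : {S : Signature} → Term S → Set
IsVar (var _)   = ⊤
IsVar (fun _ _) = ⊥

record Rule (S : Signature) : Set where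
  constructor _⟶_∣_
  field
    lhs : Term S
    rhs : Term S
    lhs-not-var : ¬ IsVar lhs
open Rule public

RewriteSystem : Signature → Set₁
RewriteSystem S = Rule S → Set

module _ {S : Signature} (R : RewriteSystem S) where

  mutual
    data Step : Term S → Term S → Set where
      root : (ρ : Rule S) → R ρ → (θ : Subst S) →
             Step (subst θ (lhs ρ)) (subst θ (rhs ρ))
      arg  : (f : Fun S) {ts us : Vec (Term S) (funArity S f)} →
             Steps ts us → Step (fun f ts) (fun f us)

    data Steps : {n : ℕ} → Vec (Term S) n → Vec (Term S) n → Set where
      here  : ∀ {n t u} {ts : Vec (Term S) n} → Step t u → Steps (t ∷ ts) (u ∷ ts)
      there : ∀ {n t} {ts us : Vec (Term S) n} → Steps ts us → Steps (t ∷ ts) (t ∷ us)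

  data PStep : Prop S → Prop S → Set where
    arg : (P : Pred S) {ts us : Vec (Term S) (predArity S P)} →
          Steps ts us → PStep (pred P ts) (pred P us)

  _⟶*_ : Term S → Term S → Set
  _⟶*_ = Star Step

  _⇒*_ : Prop S → Prop S → Set
  _⇒*_ = Star PStep

  LocallyConfluent : Set
  LocallyConfluent = ∀ {t u v} → Step t u → Step t v → ∃[ w ] (u ⟶* w × v ⟶* w)

  CommonReduct : Prop S → Prop S → Set
  CommonReduct A B = ∃[ D ] (A ⇒* D × B ⇒* D)

  -- Asymmetric atomic deduction modulo R.  Sequents Γ ⊢ Δ are pairs of
  -- lists considered up to permutation (multisets).

  data Proof : List (Prop S) → List (Prop S) → Set where
    axiom : ∀ {Γ Δ Γ' Δ' A₁ A₂} (A : Prop S) →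
            Γ ↭ (A₁ ∷ Γ') → Δ ↭ (A₂ ∷ Δ') → A₁ ⇒* A → A₂ ⇒* A →
            Proof Γ Δ
    cut   : ∀ {Γ Δ C₁ C₂} (C : Prop S) → C ⇒* C₁ → C ⇒* C₂ →
            Proof Γ (C₁ ∷ Δ) → Proof (C₂ ∷ Γ) Δ → Proof Γ Δ
    contrL : ∀ {Γ Γ' Δ A A₁ A₂} → Γ ↭ (A ∷ Γ') → A ⇒* A₁ → A ⇒* A₂ →
             Proof (A₁ ∷ A₂ ∷ Γ') Δ → Proof Γ Δ
    contrR : ∀ {Γ Δ Δ' A A₁ A₂} → Δ ↭ (A ∷ Δ') → A ⇒* A₁ → A ⇒* A₂ →
             Proof Γ (A₁ ∷ A₂ ∷ Δ') → Proof Γ Δ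
    weakL : ∀ {Γ Γ' Δ A} → Γ ↭ (A ∷ Γ') → Proof Γ' Δ → Proof Γ Δ
    weakR : ∀ {Γ Δ Δ' A} → Δ ↭ (A ∷ Δ') → Proof Γ Δ' → Proof Γ Δ

  data CutFree : ∀ {Γ Δ} → Proof Γ Δ → Set where
    axiom  : ∀ {Γ Δ Γ' Δ' A₁ A₂ A} {p : Γ ↭ (A₁ ∷ Γ')} {q : Δ ↭ (A₂ ∷ Δ')}
               {r : A₁ ⇒* A} {s : A₂ ⇒* A} → CutFree (axiom A p q r s)
    contrL : ∀ {Γ Γ' Δ A A₁ A₂} {p : Γ ↭ (A ∷ Γ')} {r : A ⇒* A₁} {s : A ⇒* A₂}
               {π : Proof (A₁ ∷ A₂ ∷ Γ') Δ} → CutFree π → CutFree (contrL p r s π)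
    contrR : ∀ {Γ Δ Δ' A A₁ A₂} {p : Δ ↭ (A ∷ Δ')} {r : A ⇒* A₁} {s : A ⇒* A₂}
               {π : Proof Γ (A₁ ∷ A₂ ∷ Δ')} → CutFree π → CutFree (contrR p r s π)
    weakL  : ∀ {Γ Γ' Δ A} {p : Γ ↭ (A ∷ Γ')} {π : Proof Γ' Δ} → CutFree π → CutFree (weakL p π)
    weakR  : ∀ {Γ Δ Δ' A} {p : Δ ↭ (A ∷ Δ')} {π : Proof Γ Δ'} → CutFree π → CutFree (weakR p π)

  -- The cases of the reduction step applied to a cut with cut
  -- proposition C, conclusion Γ ⊢ Δ, premises Γ ⊢ C₁, Δ and Γ, C₂ ⊢ Δ.

  Case1 : List (Prop S) → List (Prop S) → Set
  Case1 Γ Δ = ∃[ A ] ∃[ E ] (A ∈ Γ × E ∈ Δ × CommonReduct A E)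

  record Decomposition (Γ Δ : List (Prop S)) (C₁ C₂ : Prop S) : Set where
    field
      Γ' Δ'   : List (Prop S)
      A E B D : Prop S
      Γ-split : Γ ↭ (A ∷ Γ')
      Δ-split : Δ ↭ (E ∷ Δ')
      A⇒B     : A ⇒* B
      C₁⇒B    : C₁ ⇒* B
      E⇒D     : E ⇒* D
      C₂⇒D    : C₂ ⇒* D

  record Picks (C B D : Prop S) : Set where
    field
      C₁' C₂'  : Prop S
      C⇒C₁'    : PStep C C₁'
      C₁'⇒B    : C₁' ⇒* B
      C⇒C₂'    : PStep C C₂'
      C₂'⇒D    : C₂' ⇒* D

  StepDoesNotFail : (Γ Δ : List (Prop S)) (C C₁ C₂ : Prop S) → Set
  StepDoesNotFail Γ Δ C C₁ C₂ =
    ¬ Case1 Γ Δ →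
    Decomposition Γ Δ C₁ C₂ ×
    ((d : Decomposition Γ Δ C₁ C₂) →
      Decomposition.B d ≢ C → C ≢ Decomposition.D d →
      Picks C (Decomposition.B d) (Decomposition.D d) ×
      ((p : Picks C (Decomposition.B d) (Decomposition.D d)) →
        CommonReduct (Picks.C₁' p) (Picks.C₂' p)))

module Submission where

open import Data.List using (List; _∷_; _++_)
open import Data.Vec using (Vec; _∷_)
open import Data.Product using (∃-syntax; _×_; _,_)
open import Data.Empty using (⊥-elim)
open import Data.List.Membership.Propositional using (_∈_)
open import Data.List.Membership.Propositional.Properties using (∈-∃++)
open import Data.List.Relation.Unary.Any using (here; there)
open import Data.List.Relation.Binary.Permutation.Propositional using (_↭_; ↭-sym)
open import Data.List.Relation.Binary.Permutation.Propositional.Properties using (∈-resp-↭; shift)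
open import Relation.Nullary using (¬_)
open import Relation.Binary.PropositionalEquality using (_≢_; ≢-sym; refl)
open import Relation.Binary.Construct.Closure.ReflexiveTransitive using (Star; ε; _◅_; _◅◅_; gmap)
open import Defs

-- A cut-free proof is an axiom followed by weakenings and contractions, and
-- each member of the premise of such a rule is a reduct of a member of its
-- conclusion (Γ ⊆* Γ₀ below); so the conclusion of a cut-free proof still
-- has a left and a right member with a common reduct.  When case (1)
-- fails, these pairs in the two premises of the cut must involve C₁ and C₂,
-- which yields the decomposition.  If B ≠ C and C ≠ D, both reductions
-- C →* B and C →* D start with a step, and local confluence lifted from
-- terms to propositions joins these first steps: case (3) applies.

∈⇒↭-∷ : ∀ {a} {A : Set a} {x : A} {xs : List A} → x ∈ xs → ∃[ ys ] (xs ↭ x ∷ ys)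
∈⇒↭-∷ {x = x} x∈xs with ys , zs , refl ← ∈-∃++ x∈xs = ys ++ zs , shift x ys zs

module _ {S : Signature} (R : RewriteSystem S) where

  _⊆*_ : List (Prop S) → List (Prop S) → Set
  Γ ⊆* Γ₀ = ∀ {X} → X ∈ Γ → ∃[ Y ] (Y ∈ Γ₀ × _⇒*_ R Y X)

  ⊆*-refl : ∀ {Γ} → Γ ⊆* Γ
  ⊆*-refl X∈Γ = _ , X∈Γ , ε

  ↭⇒⊆* : ∀ {Γ Γ₀} → Γ₀ ↭ Γ → Γ ⊆* Γ₀
  ↭⇒⊆* Γ₀↭Γ X∈Γ = _ , ∈-resp-↭ (↭-sym Γ₀↭Γ) X∈Γ , ε

  ∷⊆* : ∀ {A Γ} → Γ ⊆* (A ∷ Γ)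
  ∷⊆* X∈Γ = _ , there X∈Γ , ε

  contraction⊆* : ∀ {A A₁ A₂ Γ} → _⇒*_ R A A₁ → _⇒*_ R A A₂ → (A₁ ∷ A₂ ∷ Γ) ⊆* (A ∷ Γ)
  contraction⊆* A⇒A₁ A⇒A₂ (here refl)         = _ , here refl , A⇒A₁
  contraction⊆* A⇒A₁ A⇒A₂ (there (here refl)) = _ , here refl , A⇒A₂
  contraction⊆* A⇒A₁ A⇒A₂ (there (there X∈Γ)) = _ , there X∈Γ , ε

  ⊆*-trans : ∀ {Γ₁ Γ₂ Γ₃} → Γ₁ ⊆* Γ₂ → Γ₂ ⊆* Γ₃ → Γ₁ ⊆* Γ₃
  ⊆*-trans Γ₁⊆Γ₂ Γ₂⊆Γ₃ X∈Γ₁ with Y , Y∈Γ₂ , Y⇒X ← Γ₁⊆Γ₂ X∈Γ₁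
                           with Z , Z∈Γ₃ , Z⇒Y ← Γ₂⊆Γ₃ Y∈Γ₂ = Z , Z∈Γ₃ , Z⇒Y ◅◅ Y⇒X

  Case1-mono : ∀ {Γ Δ Γ₀ Δ₀} → Γ ⊆* Γ₀ → Δ ⊆* Δ₀ → Case1 R Γ Δ → Case1 R Γ₀ Δ₀
  Case1-mono Γ⊆Γ₀ Δ⊆Δ₀ (A , E , A∈Γ , E∈Δ , D , A⇒D , E⇒D)
    with A₀ , A₀∈Γ₀ , A₀⇒A ← Γ⊆Γ₀ A∈Γ
    with E₀ , E₀∈Δ₀ , E₀⇒E ← Δ⊆Δ₀ E∈Δ
    = A₀ , E₀ , A₀∈Γ₀ , E₀∈Δ₀ , D , A₀⇒A ◅◅ A⇒D , E₀⇒E ◅◅ E⇒D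

  cutFree⇒Case1 : ∀ {Γ Δ} {π : Proof R Γ Δ} → CutFree R π → Case1 R Γ Δ
  cutFree⇒Case1 (axiom {p = Γ↭} {q = Δ↭} {r = A₁⇒A} {s = A₂⇒A}) =
    _ , _ , ∈-resp-↭ (↭-sym Γ↭) (here refl) , ∈-resp-↭ (↭-sym Δ↭) (here refl) , _ , A₁⇒A , A₂⇒A
  cutFree⇒Case1 (contrL {p = Γ↭} {r = r} {s = s} π) =
    Case1-mono (⊆*-trans (contraction⊆* r s) (↭⇒⊆* Γ↭)) ⊆*-refl (cutFree⇒Case1 π)
  cutFree⇒Case1 (contrR {p = Δ↭} {r = r} {s = s} π) =
    Case1-mono ⊆*-refl (⊆*-trans (contraction⊆* r s) (↭⇒⊆* Δ↭)) (cutFree⇒Case1 π)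
  cutFree⇒Case1 (weakL {p = Γ↭} π) =
    Case1-mono (⊆*-trans ∷⊆* (↭⇒⊆* Γ↭)) ⊆*-refl (cutFree⇒Case1 π)
  cutFree⇒Case1 (weakR {p = Δ↭} π) =
    Case1-mono ⊆*-refl (⊆*-trans ∷⊆* (↭⇒⊆* Δ↭)) (cutFree⇒Case1 π)

  Case1-∷ʳ : ∀ {Γ Δ C} → ¬ Case1 R Γ Δ → Case1 R Γ (C ∷ Δ) → ∃[ A ] (A ∈ Γ × CommonReduct R A C)
  Case1-∷ʳ ¬case1 (A , _ , A∈Γ , here refl , A~C)  = A , A∈Γ , A~C
  Case1-∷ʳ ¬case1 (A , E , A∈Γ , there E∈Δ , A~E) = ⊥-elim (¬case1 (A , E , A∈Γ , E∈Δ , A~E))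

  Case1-∷ˡ : ∀ {Γ Δ C} → ¬ Case1 R Γ Δ → Case1 R (C ∷ Γ) Δ → ∃[ E ] (E ∈ Δ × CommonReduct R E C)
  Case1-∷ˡ ¬case1 (_ , E , here refl , E∈Δ , D , C⇒D , E⇒D) = E , E∈Δ , D , E⇒D , C⇒D
  Case1-∷ˡ ¬case1 (A , E , there A∈Γ , E∈Δ , A~E)       = ⊥-elim (¬case1 (A , E , A∈Γ , E∈Δ , A~E))

  decomposition : ∀ {Γ Δ C₁ C₂} → ¬ Case1 R Γ Δ →
                  Case1 R Γ (C₁ ∷ Δ) → Case1 R (C₂ ∷ Γ) Δ → Decomposition R Γ Δ C₁ C₂
  decomposition ¬case1 case1₁ case1₂
    with A , A∈Γ , B , A⇒B , C₁⇒B ← Case1-∷ʳ ¬case1 case1₁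
    with E , E∈Δ , D , E⇒D , C₂⇒D ← Case1-∷ˡ ¬case1 case1₂
    with Γ' , Γ↭ ← ∈⇒↭-∷ A∈Γ
    with Δ' , Δ↭ ← ∈⇒↭-∷ E∈Δ
    = record { Γ' = Γ' ; Δ' = Δ' ; A = A ; E = E ; B = B ; D = D
             ; Γ-split = Γ↭ ; Δ-split = Δ↭ ; A⇒B = A⇒B ; C₁⇒B = C₁⇒B ; E⇒D = E⇒D ; C₂⇒D = C₂⇒D }

  module _ (lc : LocallyConfluent R) where

    steps-locallyConfluent : ∀ {n} {ts us vs : Vec (Term S) n} → Steps R ts us → Steps R ts vs →
                             ∃[ ws ] (Star (Steps R) us ws × Star (Steps R) vs ws)
    steps-locallyConfluent (here t→u) (here t→v) with w , u⇒w , v⇒w ← lc t→u t→v =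
      _ , gmap _ here u⇒w , gmap _ here v⇒w
    steps-locallyConfluent (here t→u) (there ts→vs) = _ , there ts→vs ◅ ε , here t→u ◅ ε
    steps-locallyConfluent (there ts→us) (here t→v) = _ , here t→v ◅ ε , there ts→us ◅ ε
    steps-locallyConfluent (there ts→us) (there ts→vs)
      with ws , us⇒ws , vs⇒ws ← steps-locallyConfluent ts→us ts→vs =
      _ , gmap _ there us⇒ws , gmap _ there vs⇒ws

    pStep-locallyConfluent : ∀ {A B C} → PStep R A B → PStep R A C → CommonReduct R B C
    pStep-locallyConfluent (arg P ts→us) (arg .P ts→vs)
      with ws , us⇒ws , vs⇒ws ← steps-locallyConfluent ts→us ts→vs =
      pred P ws , gmap _ (arg P) us⇒ws , gmap _ (arg P) vs⇒ws

  ⇒*-uncons : ∀ {C B} → _⇒*_ R C B → B ≢ C → ∃[ C' ] (PStep R C C' × _⇒*_ R C' B)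
  ⇒*-uncons ε                B≢C = ⊥-elim (B≢C refl)
  ⇒*-uncons (C→C' ◅ C'⇒B) _ = _ , C→C' , C'⇒B

  picks : ∀ {C B D} → _⇒*_ R C B → _⇒*_ R C D → B ≢ C → C ≢ D → Picks R C B D
  picks C⇒B C⇒D B≢C C≢D
    with C₁' , C→C₁' , C₁'⇒B ← ⇒*-uncons C⇒B B≢C
    with C₂' , C→C₂' , C₂'⇒D ← ⇒*-uncons C⇒D (≢-sym C≢D)
    = record { C₁' = C₁' ; C₂' = C₂' ; C⇒C₁' = C→C₁' ; C₁'⇒B = C₁'⇒B ; C⇒C₂' = C→C₂' ; C₂'⇒D = C₂'⇒D }

proposition6 : (S : Signature) (R : RewriteSystem S) → LocallyConfluent R →
    (Γ Δ : List (Prop S)) (C C₁ C₂ : Prop S) →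
    _⇒*_ R C C₁ → _⇒*_ R C C₂ →
    (π₁ : Proof R Γ (C₁ ∷ Δ)) → CutFree R π₁ →
    (π₂ : Proof R (C₂ ∷ Γ) Δ) → CutFree R π₂ →
    StepDoesNotFail R Γ Δ C C₁ C₂
proposition6 S R lc Γ Δ C C₁ C₂ C⇒C₁ C⇒C₂ π₁ cf₁ π₂ cf₂ ¬case1 =
  decomposition R ¬case1 (cutFree⇒Case1 R cf₁) (cutFree⇒Case1 R cf₂) ,
  λ d B≢C C≢D →
    picks R (C⇒C₁ ◅◅ Decomposition.C₁⇒B d) (C⇒C₂ ◅◅ Decomposition.C₂⇒D d) B≢C C≢D ,
    λ p → pStep-locallyConfluent R lc (Picks.C⇒C₁' p) (Picks.C⇒C₂' p)
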